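{- None of the following classes is closed under bisimulation: - the class of $\lambda$-term-graphs over $\Sigma^\lambda_1$; - the classes of $\lambda$-term-graphs over $\Sigma^\lambda_{ij}$, for each $i\in\{0,1\}$ and $j\in\{1,2\}$. Here a class $\mathcal K$ of term graphs over a signature $\Sigma$ is closed under bisimulation if, whenever $G\in\mathcal K$ and $G'$ is a term graph over $\Sigma$ bisimilar to $G$, also $G'\in\mathcal K$.
   Context: Term graphs. A term graph over a signature $\Sigma$ is a tuple $(V,\mathit{lab},\mathit{args},r)$, where: - $\mathit{args}(v)\in V^*$ has length equal to the arity of $\mathit{lab}(v)$; - every vertex is reachable from the root $r$. Write $w\rightarrowtail_kw'$ if $w'$ is the $k$-th entry (from $0$) of $\mathit{args}(w)$. Homomorphisms and bisimilarity. A homomorphism $h:G_1\to G_2$ satisfies $h(r_1)=r_2$, preserves labels, and has $\mathit{args}_2(h(v))=\bar h(\mathit{args}_1(v))$. Two term graphs $G_1,G_2$ are bisimilar if there is a relation $R\subseteq V_1\times V_2$ such that: - $(r_1,r_2)\in R$; - for all $(v,v')\in R$, $\mathit{lab}_1(v)=\mathit{lab}_2(v')$; - for all $(v,v')\in R$, the $k$-th arguments of $v$ and $v'$ are related by $R$ for every $k$. Notation. $\Sigma^\lambda_1=\{@,\lambda,0\}$ with arities $2,1,1$. $\Sigma^\lambda_{ij}=\{@,\lambda,0,S\}$ with arities $2,1,i,j$. For words: $\epsilon$ is empty, juxtaposition is concatenation, $\le$ is the prefix order. $\lambda$-term-graphs over $\Sigma^\lambda_1$. A term graph over $\Sigma^\lambda_1$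 is a $\lambda$-term-graph over $\Sigma^\lambda_1$ if it admits $P:V\to V^*$ with: - $P(r)=\epsilon$; - $\lambda$-vertex $w\rightarrowtail_0w_0$ implies $P(w_0)\le P(w)w$; - $@$-vertex $w\rightarrowtail_kw_k$ implies $P(w_k)\le P(w)$; - $0$-vertex $w$ implies $P(w)\neq\epsilon$; - $0$-vertex $w\rightarrowtail_0 w_0$ implies $w_0$ labelled $\lambda$ and $P(w_0)w_0=P(w)$. $\lambda$-term-graphs over $\Sigma^\lambda_{ij}$. A term graph over $\Sigma^\lambda_{ij}$ is a $\lambda$-term-graph if it admits $P:V\to V^*$ with: - $P(r)=\epsilon$; - $\lambda$-vertex $w\rightarrowtail_0w_0$ implies $P(w_0)=P(w)w$; - $@$-vertex $w\rightarrowtail_kw_k$ implies $P(w_k)=P(w)$; - $0$-vertex $w$ implies $P(w)\ne\epsilon$; - $0$-vertex $w\rightarrowtail_0w_0$ implies $w_0$ labelled $\lambda$ and $P(w_0)w_0=P(w)$; - $S$-vertex $w\rightarrowtail_0w_0$ implies $P(w_0)v=P(w)$ for some $v$; - $S$-vertex $w\rightarrowtail_1w_1$ implies $w_1$ labelled $\lambda$ and $P(w_1)w_1=P(w)$. -}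

module Defs where

open import Data.Nat using (ℕ; zero; suc; _≤_)
open import Data.Fin using (Fin; toℕ)
open import Data.Vec using (Vec; lookup)
open import Data.List using (List; []; _++_; [_])
open import Data.Product using (Σ; ∃; _×_; _,_)
open import Relation.Binary.PropositionalEquality using (_≡_)
open import Relation.Nullary using (¬_)

record Signature : Set₁ where
  field
    Sym : Set
    ar  : Sym → ℕ
open Signature public

data Reach {V : Set} {Sy : Set} (arity : Sy → ℕ)
           (lab : V → Sy) (args : (v : V) → Vec V (arity (lab v)))
           (r : V) : V → Set where
  here : Reach arity lab args r r
  step : ∀ {w} → Reach arity lab args r w → (k : Fin (arity (lab w))) →
         Reach arity lab args r (lookup (args w) k)

record TermGraph (Sg : Signature) : Set₁ where
  field
    V     : Set
    lab   : V → Sym Sg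
    args  : (v : V) → Vec V (ar Sg (lab v))
    root  : V
    reach : (v : V) → Reach (ar Sg) lab args root v
open TermGraph public

-- w ↣_k w' : w' is the k-th (from 0) entry of args(w)
Edge : ∀ {Sg} (G : TermGraph Sg) → V G → ℕ → V G → Set
Edge {Sg} G w k w' =
  Σ (Fin (ar Sg (lab G w))) λ k' → (toℕ k' ≡ k) × (lookup (args G w) k' ≡ w')

Bisimilar : ∀ {Sg} → TermGraph Sg → TermGraph Sg → Set₁
Bisimilar {Sg} G₁ G₂ =
  Σ (V G₁ → V G₂ → Set) λ R →
    R (root G₁) (root G₂)
    × (∀ v v' → R v v' → lab G₁ v ≡ lab G₂ v')
    × (∀ v v' k w w' → R v v' → Edge G₁ v k w → Edge G₂ v' k w' → R w w')

ClosedUnderBisimulation : ∀ {Sg} → (TermGraph Sg → Set) → Set₁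
ClosedUnderBisimulation {Sg} K =
  (G G' : TermGraph Sg) → K G → Bisimilar G G' → K G'

_≼_ : {A : Set} → List A → List A → Set
xs ≼ ys = ∃ λ zs → xs ++ zs ≡ ys

-- Σ^λ_1 = {@, λ, 0} with arities 2, 1, 1.
data Sym₁ : Set where
  app lam var : Sym₁

ar₁ : Sym₁ → ℕ
ar₁ app = 2
ar₁ lam = 1
ar₁ var = 1

Σλ₁ : Signature
Σλ₁ = record { Sym = Sym₁ ; ar = ar₁ }

-- Σ^λ_ij = {@, λ, 0, S} with arities 2, 1, i, j.
data Symᵢⱼ : Set where
  app lam var S : Symᵢⱼ

arᵢⱼ : ℕ → ℕ → Symᵢⱼ → ℕ
arᵢⱼ i j app = 2
arᵢⱼ i j lam = 1
arᵢⱼ i j var = i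
arᵢⱼ i j S   = j

Σλ : ℕ → ℕ → Signature
Σλ i j = record { Sym = Symᵢⱼ ; ar = arᵢⱼ i j }

Isλ₁ : TermGraph Σλ₁ → Set
Isλ₁ G = Σ (V G → List (V G)) λ P →
    (P (root G) ≡ [])
  × (∀ w k w₀ → lab G w ≡ Sym₁.lam → Edge G w k w₀ → P w₀ ≼ (P w ++ [ w ]))
  × (∀ w k wₖ → lab G w ≡ Sym₁.app → Edge G w k wₖ → P wₖ ≼ P w)
  × (∀ w → lab G w ≡ Sym₁.var → ¬ (P w ≡ []))
  × (∀ w w₀ → lab G w ≡ Sym₁.var → Edge G w 0 w₀ →
       (lab G w₀ ≡ Sym₁.lam) × (P w₀ ++ [ w₀ ] ≡ P w))

Isλᵢⱼ : ∀ i j → TermGraph (Σλ i j) → Set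
Isλᵢⱼ i j G = Σ (V G → List (V G)) λ P →
    (P (root G) ≡ [])
  × (∀ w k w₀ → lab G w ≡ Symᵢⱼ.lam → Edge G w k w₀ → P w₀ ≡ P w ++ [ w ])
  × (∀ w k wₖ → lab G w ≡ Symᵢⱼ.app → Edge G w k wₖ → P wₖ ≡ P w)
  × (∀ w → lab G w ≡ Symᵢⱼ.var → ¬ (P w ≡ []))
  × (∀ w w₀ → lab G w ≡ Symᵢⱼ.var → Edge G w 0 w₀ →
       (lab G w₀ ≡ Symᵢⱼ.lam) × (P w₀ ++ [ w₀ ] ≡ P w))
  × (∀ w w₀ → lab G w ≡ Symᵢⱼ.S → Edge G w 0 w₀ →
       ∃ λ v → P w₀ ++ v ≡ P w)
  × (∀ w w₁ → lab G w ≡ Symᵢⱼ.S → Edge G w 1 w₁ →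
       (lab G w₁ ≡ Symᵢⱼ.lam) × (P w₁ ++ [ w₁ ] ≡ P w))

{-# OPTIONS --safe #-}
module Submission where

-- A λ-vertex whose body points straight back to it (through a variable vertex over Σ^λ_1,
-- through an S-vertex over Σ^λ_ij) is a λ-term-graph, and it is bisimilar to its one-step
-- unfolding, in which a second copy of the λ-vertex sits on top and shares the body. In the
-- unfolding the body is bound by the lower copy but lies in the scope of the upper one. Over
-- Σ^λ_1 the scope condition forces a variable directly below the root abstraction to be bound
-- by the root, which fails here; over Σ^λ_ij the two abstractions have a common body, and
-- P(body) = P(w)w determines w.

open import Defs
open import Data.Nat using (ℕ; _≤_; suc; zero)
open import Data.Fin using (Fin; zero)
open import Data.Fin.Properties using (toℕ-injective)
open import Data.Vec using (Vec; replicate; lookup)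
open import Data.Vec.Properties using (lookup-replicate)
open import Data.List using (List; []; _∷_; _++_; [_]; _∷ʳ_)
open import Data.List.Properties
  using (∷-injectiveˡ; ∷-injectiveʳ; ++-conicalˡ; ++-conicalʳ; ∷ʳ-injectiveʳ)
open import Data.Product using (_×_; _,_; ∃)
open import Relation.Nullary using (¬_)
open import Relation.Binary.PropositionalEquality using (_≡_; refl; sym; trans; cong; subst)

∷ʳ-≼-singleton⇒≡ : ∀ {A : Set} (xs : List A) {x y : A} → (xs ∷ʳ x) ≼ [ y ] → x ≡ y
∷ʳ-≼-singleton⇒≡ []       (zs , eq) = ∷-injectiveˡ eq
∷ʳ-≼-singleton⇒≡ (_ ∷ xs) {x} (zs , eq)
  with () ← ++-conicalʳ xs [ x ] (++-conicalˡ (xs ∷ʳ x) zs (∷-injectiveʳ eq))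

Edge-functional : ∀ {Sg} (G : TermGraph Sg) {v k w w'} →
                  Edge G v k w → Edge G v k w' → w ≡ w'
Edge-functional G {v} (k₁ , p₁ , e₁) (k₂ , p₂ , e₂) =
  trans (sym e₁) (trans (cong (lookup (args G v)) (toℕ-injective (trans p₁ (sym p₂)))) e₂)

Edge-replicate : ∀ {Sg} (G : TermGraph Sg) {v u k w} →
                 args G v ≡ replicate _ u → Edge G v k w → w ≡ u
Edge-replicate G {u = u} eq (k' , _ , e) =
  trans (sym e) (trans (cong (λ xs → lookup xs k') eq) (lookup-replicate k' u))

step-replicate : ∀ {V Sy : Set} {arity : Sy → ℕ} {lab : V → Sy}
                   {args : (v : V) → Vec V (arity (lab v))} {r w u} →
                 Reach arity lab args r w → args w ≡ replicate _ u →
                 Fin (arity (lab w)) → Reach arity lab args r u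
step-replicate {u = u} ρ eq k =
  subst (Reach _ _ _ _) (trans (cong (λ xs → lookup xs k) eq) (lookup-replicate k u)) (step ρ k)

-- The condition args₂(h v) = h̄(args₁ v) is stated edgewise, which avoids transporting
-- args₂(h v) along the label equation.
record Homomorphism {Sg} (G₁ G₂ : TermGraph Sg) : Set where
  field
    map      : V G₁ → V G₂
    map-root : map (root G₁) ≡ root G₂
    map-lab  : ∀ v → lab G₂ (map v) ≡ lab G₁ v
    map-edge : ∀ {v k w} → Edge G₁ v k w → Edge G₂ (map v) k (map w)

Homomorphism⇒Bisimilar : ∀ {Sg} {G₁ G₂ : TermGraph Sg} →
                         Homomorphism G₁ G₂ → Bisimilar G₂ G₁
Homomorphism⇒Bisimilar {G₂ = G₂} h =
  (λ u v → map v ≡ u) , map-root , (λ { _ v refl → map-lab v })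
  , λ { _ _ _ _ _ refl e e' → Edge-functional G₂ (map-edge e') e }
  where open Homomorphism h

counterexample⇒¬closed : ∀ {Sg} {K : TermGraph Sg → Set} (G H : TermGraph Sg) →
                         K G → Bisimilar G H → ¬ K H → ¬ ClosedUnderBisimulation K
counterexample⇒¬closed G H G∈K G≈H H∉K closed = H∉K (closed G H G∈K G≈H)

-- k-abs and k-back only witness that both arities are positive, which reachability needs.
module Unfolding {Sg : Signature} (abs back : Sym Sg)
                 (k-abs : Fin (ar Sg abs)) (k-back : Fin (ar Sg back)) where

  data CycleVertex : Set where
    abstraction body : CycleVertex

  cycle-lab : CycleVertex → Sym Sg
  cycle-lab abstraction = abs
  cycle-lab body        = back

  cycle-next : CycleVertex → CycleVertex
  cycle-next abstraction = body
  cycle-next body        = abstraction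

  cycle-args : (v : CycleVertex) → Vec CycleVertex (ar Sg (cycle-lab v))
  cycle-args v = replicate _ (cycle-next v)

  cycle : TermGraph Sg
  cycle = record
    { V = CycleVertex ; lab = cycle-lab ; args = cycle-args ; root = abstraction
    ; reach = λ { abstraction → here ; body → step-replicate here refl k-abs } }

  cycle-edge : ∀ v {k w} → Edge cycle v k w → w ≡ cycle-next v
  cycle-edge v = Edge-replicate cycle {v} refl

  cycle-scope : CycleVertex → List CycleVertex
  cycle-scope abstraction = []
  cycle-scope body        = [ abstraction ]

  data UnfoldedVertex : Set where
    outer abstraction body : UnfoldedVertex

  unfolded-lab : UnfoldedVertex → Sym Sg
  unfolded-lab outer       = abs
  unfolded-lab abstraction = abs
  unfolded-lab body        = back

  unfolded-next : UnfoldedVertex → UnfoldedVertex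
  unfolded-next outer       = body
  unfolded-next abstraction = body
  unfolded-next body        = abstraction

  unfolded-args : (v : UnfoldedVertex) → Vec UnfoldedVertex (ar Sg (unfolded-lab v))
  unfolded-args v = replicate _ (unfolded-next v)

  unfolded : TermGraph Sg
  unfolded = record
    { V = UnfoldedVertex ; lab = unfolded-lab ; args = unfolded-args ; root = outer
    ; reach = λ { outer       → here
                ; body        → step-replicate here refl k-abs
                ; abstraction → step-replicate (step-replicate here refl k-abs) refl k-back } }

  unfolded-edge : ∀ v {k w} → Edge unfolded v k w → w ≡ unfolded-next v
  unfolded-edge v = Edge-replicate unfolded {v} refl

  fold : UnfoldedVertex → CycleVertex
  fold outer       = abstraction
  fold abstraction = abstraction
  fold body        = body

  fold-edge : ∀ {v k w} → Edge unfolded v k w → Edge cycle (fold v) k (fold w)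
  fold-edge {outer} e@(k' , p , _) with refl ← unfolded-edge outer e =
    k' , p , lookup-replicate k' body
  fold-edge {abstraction} e@(k' , p , _) with refl ← unfolded-edge abstraction e =
    k' , p , lookup-replicate k' body
  fold-edge {body} e@(k' , p , _) with refl ← unfolded-edge body e =
    k' , p , lookup-replicate k' abstraction

  fold-homomorphism : Homomorphism unfolded cycle
  fold-homomorphism = record
    { map = fold ; map-root = refl
    ; map-lab = λ { outer → refl ; abstraction → refl ; body → refl }
    ; map-edge = fold-edge }

  cycle≈unfolded : Bisimilar cycle unfolded
  cycle≈unfolded = Homomorphism⇒Bisimilar fold-homomorphism

var-under-root-bound-by-root : ∀ {G} → Isλ₁ G → ∀ {v u} →
  lab G (root G) ≡ Sym₁.lam → Edge G (root G) 0 v →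
  lab G v ≡ Sym₁.var → Edge G v 0 u → u ≡ root G
var-under-root-bound-by-root {G} (P , P-root , P-lam , _ , _ , P-var) {v} {u}
                             root-lam e₀ v-var e₁
  with zs , Pv≼ ← P-lam (root G) 0 v root-lam e₀
     | _ , Pu∷ʳu≡Pv ← P-var v u v-var e₁ =
  ∷ʳ-≼-singleton⇒≡ (P u)
    (zs , trans (cong (_++ zs) Pu∷ʳu≡Pv) (trans Pv≼ (cong (_∷ʳ root G) P-root)))

abstraction-determined-by-body : ∀ {i j G} → Isλᵢⱼ i j G → ∀ {w w' b} →
  lab G w ≡ Symᵢⱼ.lam → lab G w' ≡ Symᵢⱼ.lam → Edge G w 0 b → Edge G w' 0 b → w ≡ w'
abstraction-determined-by-body (P , _ , P-lam , _) {w} {w'} {b} w-lam w'-lam e e' =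
  ∷ʳ-injectiveʳ (P w) (P w') (trans (sym (P-lam w 0 b w-lam e)) (P-lam w' 0 b w'-lam e'))

module Cycle₁ = Unfolding {Σλ₁} Sym₁.lam Sym₁.var zero zero

cycle-isλ₁ : Isλ₁ Cycle₁.cycle
cycle-isλ₁ =
  cycle-scope , refl , lam-edge , (λ { abstraction _ _ () ; body _ _ () })
  , (λ { abstraction () ; body _ () }) , var-edge
  where
  open Cycle₁

  lam-edge : ∀ w k w₀ → cycle-lab w ≡ Sym₁.lam → Edge cycle w k w₀ →
             cycle-scope w₀ ≼ (cycle-scope w ∷ʳ w)
  lam-edge abstraction _ _ _ e with refl ← cycle-edge abstraction e = [] , refl

  var-edge : ∀ w w₀ → cycle-lab w ≡ Sym₁.var → Edge cycle w 0 w₀ →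
             (cycle-lab w₀ ≡ Sym₁.lam) × (cycle-scope w₀ ∷ʳ w₀ ≡ cycle-scope w)
  var-edge body _ _ e with refl ← cycle-edge body e = refl , refl

unfolded-¬isλ₁ : ¬ Isλ₁ Cycle₁.unfolded
unfolded-¬isλ₁ isλ
  with () ← var-under-root-bound-by-root {Cycle₁.unfolded} isλ
               refl (zero , refl , refl) refl (zero , refl , refl)

module Cycleᵢⱼ (i j : ℕ) = Unfolding {Σλ i (suc j)} Symᵢⱼ.lam Symᵢⱼ.S zero zero

cycle-isλᵢⱼ : ∀ i j → Isλᵢⱼ i (suc j) (Cycleᵢⱼ.cycle i j)
cycle-isλᵢⱼ i j =
  cycle-scope , refl , lam-edge , (λ { abstraction _ _ () ; body _ _ () })
  , (λ { abstraction () ; body () }) , (λ { abstraction _ () ; body _ () })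
  , S-edge₀ , S-edge₁
  where
  open Cycleᵢⱼ i j

  lam-edge : ∀ w k w₀ → cycle-lab w ≡ Symᵢⱼ.lam → Edge cycle w k w₀ →
             cycle-scope w₀ ≡ cycle-scope w ∷ʳ w
  lam-edge abstraction _ _ _ e with refl ← cycle-edge abstraction e = refl

  S-edge₀ : ∀ w w₀ → cycle-lab w ≡ Symᵢⱼ.S → Edge cycle w 0 w₀ →
            ∃ λ v → cycle-scope w₀ ++ v ≡ cycle-scope w
  S-edge₀ body _ _ e with refl ← cycle-edge body e = [ abstraction ] , refl

  S-edge₁ : ∀ w w₁ → cycle-lab w ≡ Symᵢⱼ.S → Edge cycle w 1 w₁ →
            (cycle-lab w₁ ≡ Symᵢⱼ.lam) × (cycle-scope w₁ ∷ʳ w₁ ≡ cycle-scope w)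
  S-edge₁ body _ _ e with refl ← cycle-edge body e = refl , refl

unfolded-¬isλᵢⱼ : ∀ i j → ¬ Isλᵢⱼ i (suc j) (Cycleᵢⱼ.unfolded i j)
unfolded-¬isλᵢⱼ i j isλ
  with () ← abstraction-determined-by-body {G = Cycleᵢⱼ.unfolded i j} isλ
               {Cycleᵢⱼ.outer} {Cycleᵢⱼ.abstraction}
               refl refl (zero , refl , refl) (zero , refl , refl)

proposition6p1 : ¬ ClosedUnderBisimulation Isλ₁
                 × ((i j : ℕ) → i ≤ 1 → 1 ≤ j → j ≤ 2 →
                    ¬ ClosedUnderBisimulation (Isλᵢⱼ i j))
proposition6p1 =
  counterexample⇒¬closed Cycle₁.cycle Cycle₁.unfolded
    cycle-isλ₁ Cycle₁.cycle≈unfolded unfolded-¬isλ₁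
  , λ { i zero _ () _
      ; i (suc j) _ _ _ →
          counterexample⇒¬closed (Cycleᵢⱼ.cycle i j) (Cycleᵢⱼ.unfolded i j)
            (cycle-isλᵢⱼ i j) (Cycleᵢⱼ.cycle≈unfolded i j) (unfolded-¬isλᵢⱼ i j) }
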